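{- Let $H$ be a reflexive semicomplete digraph that contains neither $R$ nor $\vec{C}^*_3$ as an induced subdigraph, and suppose $U(H^{sym})$ is a proper interval graph. Then the vertices of $H$ can be ordered $v_1,\ldots,v_n$ such that (1) whenever $i<j<k$ and $v_iv_k\in A(H^{sym})$, we have $v_iv_j\in A(H^{sym})$ and $v_jv_k\in A(H^{sym})$; and (2) for every pair $i<j$, $v_iv_j\in A(H)$.
   Context: A reflexive semicomplete digraph has a loop at every vertex and at least one arc between every pair of distinct vertices. $H^{sym}$: digraph on $V(H)$ whose arcs are those $uv\in A(H)$ with $vu\in A(H)$. $U(\cdot)$: underlying undirected graph. Proper interval graph: (reflexive) graph isomorphic to the intersection graph of a family of inclusion-free intervals on the real line (possibly disconnected). $R$: reflexive digraph on $\{1,2,3\}$ with arcs $12,23,31,13,11,22,33$. $\vec{C}^*_3$: directed 3-cycle with a loop at each vertex.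
   Formalization: The intervals witnessing that $U(H^{sym})$ is a proper interval graph have rational endpoints rather than endpoints anywhere on the real line. -}

module Defs where

open import Data.Nat using (ℕ)
open import Data.Fin using (Fin; zero; suc; _<_)
open import Data.Product using (Σ; _×_; _,_)
open import Data.Sum using (_⊎_)
open import Data.Empty using (⊥)
open import Data.Unit using (⊤)
open import Relation.Nullary using (¬_)
open import Relation.Binary.PropositionalEquality using (_≡_; _≢_)
open import Function.Definitions using (Injective; Bijective)
import Data.Rational as ℚ
open ℚ using (ℚ)

Digraph : ℕ → Set₁
Digraph n = Fin n → Fin n → Set

Reflexive : ∀ {n} → Digraph n → Set
Reflexive {n} A = (v : Fin n) → A v v

Semicomplete : ∀ {n} → Digraph n → Set
Semicomplete {n} A = (u v : Fin n) → u ≢ v → A u v ⊎ A v u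

ReflexiveSemicomplete : ∀ {n} → Digraph n → Set
ReflexiveSemicomplete A = Reflexive A × Semicomplete A

Sym : ∀ {n} → Digraph n → Digraph n
Sym A u v = A u v × A v u

-- The digraph R on {1,2,3} = {0,1,2}: arcs 12,23,31,13 and all loops.
R : Digraph 3
R zero zero = ⊤
R (suc zero) (suc zero) = ⊤
R (suc (suc zero)) (suc (suc zero)) = ⊤
R zero (suc zero) = ⊤
R (suc zero) (suc (suc zero)) = ⊤
R (suc (suc zero)) zero = ⊤
R zero (suc (suc zero)) = ⊤
R _ _ = ⊥

C3* : Digraph 3
C3* zero zero = ⊤
C3* (suc zero) (suc zero) = ⊤
C3* (suc (suc zero)) (suc (suc zero)) = ⊤
C3* zero (suc zero) = ⊤
C3* (suc zero) (suc (suc zero)) = ⊤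
C3* (suc (suc zero)) zero = ⊤
C3* _ _ = ⊥

InducedSub : ∀ {m n} → Digraph m → Digraph n → Set
InducedSub {m} {n} B A =
  Σ (Fin m → Fin n) λ f → Injective _≡_ _≡_ f ×
    ((i j : Fin m) → (A (f i) (f j) → B i j) × (B i j → A (f i) (f j)))

record Interval : Set where
  constructor [_,_]
  field
    lo hi : ℚ
open Interval

ValidInterval : Interval → Set
ValidInterval I = lo I ℚ.≤ hi I

_⊆I_ : Interval → Interval → Set
I ⊆I J = (lo J ℚ.≤ lo I) × (hi I ℚ.≤ hi J)

Intersect : Interval → Interval → Set
Intersect I J = (lo I ℚ.≤ hi J) × (lo J ℚ.≤ hi I)

-- (Reflexive) graph G on Fin n is a proper interval graph: it is the
-- intersection graph of a family of inclusion-free intervals (no interval of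
-- the family is properly contained in another member of the family).
ProperIntervalGraph : ∀ {n} → (Fin n → Fin n → Set) → Set
ProperIntervalGraph {n} G =
  Σ (Fin n → Interval) λ I →
    ((v : Fin n) → ValidInterval (I v)) ×
    ((u v : Fin n) → I u ⊆I I v → I v ⊆I I u) ×
    ((u v : Fin n) → (G u v → Intersect (I u) (I v)) × (Intersect (I u) (I v) → G u v))

module Submission where

open import Defs
open import Data.Nat using (ℕ)
open import Data.Fin using (Fin; _<_)
open import Data.Product using (Σ; _×_)
open import Relation.Nullary using (¬_)
open import Relation.Binary.PropositionalEquality using (_≡_)
open import Function.Definitions using (Bijective)

open import Level using (0ℓ)
open import Data.Empty using (⊥; ⊥-elim)
open import Data.Unit using (⊤; tt)
open import Data.Sum using (_⊎_; inj₁; inj₂)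
import Data.Sum as Sum
open import Data.Product using (_,_; proj₁; proj₂; ∃)
import Data.Nat as ℕ
import Data.Nat.Properties as ℕ
open import Data.Fin using (fromℕ<; punchOut)
open import Data.Fin.Patterns using (0F; 1F; 2F)
import Data.Fin.Properties as Fin
open import Data.Fin.Induction using (spo-noetherian)
open import Data.List using (List; []; _∷_; filter; length; allFin)
open import Data.List.Properties using (filter-notAll; length-tabulate)
open import Data.List.Membership.Propositional.Properties using (∈-allFin; ∈-filter⁺)
import Data.List.Relation.Unary.Any as Any
import Data.Rational as ℚ
import Data.Rational.Properties as ℚ
open import Data.Product.Relation.Binary.Lex.Strict
  using (×-Lex; ×-irreflexive; ×-transitive; ×-compare)
open import Function using (id; _∘_; flip; _on_; _⇔_; mk⇔; Equivalence)
open import Function.Definitions using (Injective; Surjective)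
open import Induction.WellFounded using (Acc; acc)
open import Relation.Nullary using (Dec; yes; no; contradiction)
open import Relation.Nullary.Decidable using (_×-dec_; _→-dec_; map′)
open import Relation.Binary.Core using (Rel)
open import Relation.Binary.Definitions
  using (Decidable; DecidableEquality; Irreflexive; Transitive; Trichotomous; tri<; tri≈; tri>)
open import Relation.Binary.Structures using (IsStrictTotalOrder)
open import Relation.Binary.PropositionalEquality
  using (_≢_; refl; sym; trans; cong; subst; subst₂; resp₂; isEquivalence)
open import Relation.Binary.Construct.Closure.ReflexiveTransitive
  using (Star; ε; _◅_; _◅◅_; reverse)
  renaming (map to Star-map)

-- Ordering the vertices by the left endpoints of their intervals gives an
-- umbrella ordering ⋖ of H^sym. If w is non-adjacent in H^sym to both ends of a symmetric
-- arc xy, then the strict arcs between w and x and between w and y point the same way, for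
-- otherwise they would induce R. Hence all strict arcs between two components of H^sym
-- point the same way, and as H has no induced C⃗₃* the components are linearly ordered by
-- them. Inside one component, sliding the ends of a non-adjacent pair along paths that
-- avoid the other end shows that either every non-adjacent pair is oriented along ⋖ or
-- every one against it. Reverse ⋖ on the components of the second kind and list the
-- components in their order.

injective⇒surjective : ∀ {n} {f : Fin n → Fin n} → Injective _≡_ _≡_ f →
                       ∀ y → ∃ λ x → f x ≡ y
injective⇒surjective {ℕ.suc m} {f} f-inj y with Fin.any? (λ x → f x Fin.≟ y)
... | yes hit = hit
... | no miss = contradiction (Fin.injective⇒≤ g-inj) ℕ.1+n≰n
  where
  f≢y : ∀ x → y ≢ f x
  f≢y x y≡fx = miss (x , sym y≡fx)
  g : Fin (ℕ.suc m) → Fin m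
  g x = punchOut (f≢y x)
  g-inj : Injective _≡_ _≡_ g
  g-inj {a} {b} ga≡gb = f-inj (Fin.punchOut-injective (f≢y a) (f≢y b) ga≡gb)

filter-absorbs : ∀ {A : Set} {P Q : A → Set} (P? : ∀ x → Dec (P x)) (Q? : ∀ x → Dec (Q x)) →
                 (∀ {x} → P x → Q x) → ∀ xs → filter P? (filter Q? xs) ≡ filter P? xs
filter-absorbs P? Q? P⇒Q [] = refl
filter-absorbs P? Q? P⇒Q (x ∷ xs) with Q? x
... | yes _ with P? x
...   | yes _ = cong (x ∷_) (filter-absorbs P? Q? P⇒Q xs)
...   | no _  = filter-absorbs P? Q? P⇒Q xs
filter-absorbs P? Q? P⇒Q (x ∷ xs) | no ¬qx with P? x
...   | yes px = contradiction (P⇒Q px) ¬qx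
...   | no _   = filter-absorbs P? Q? P⇒Q xs

total⇒isStrictTotalOrder : ∀ {A : Set} {_<ᵢ_ : Rel A 0ℓ} → DecidableEquality A →
  Irreflexive _≡_ _<ᵢ_ → Transitive _<ᵢ_ → (∀ {x y} → x ≢ y → x <ᵢ y ⊎ y <ᵢ x) →
  IsStrictTotalOrder _≡_ _<ᵢ_
total⇒isStrictTotalOrder {_<ᵢ_ = _<ᵢ_} _≟_ irr tr total = record
  { isStrictPartialOrder = record
    { isEquivalence = isEquivalence ; irrefl = irr ; trans = tr ; <-resp-≈ = resp₂ _<ᵢ_ }
  ; compare = compare
  }
  where
  compare : Trichotomous _≡_ _<ᵢ_
  compare x y with x ≟ y
  ... | yes x≡y = tri≈ (irr x≡y) x≡y (irr (sym x≡y))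
  ... | no x≢y with total x≢y
  ...   | inj₁ x<y = tri< x<y x≢y (λ y<x → irr refl (tr x<y y<x))
  ...   | inj₂ y<x = tri> (λ x<y → irr refl (tr x<y y<x)) x≢y y<x

module Enumeration {n} {_≺_ : Rel (Fin n) 0ℓ} (≺-sto : IsStrictTotalOrder _≡_ _≺_) where
  open IsStrictTotalOrder ≺-sto using (compare; irrefl; _<?_) renaming (trans to ≺-trans)

  below : Fin n → List (Fin n)
  below y = filter (_<? y) (allFin n)

  rank : Fin n → ℕ
  rank y = length (below y)

  rank-mono : ∀ {x y} → x ≺ y → rank x ℕ.< rank y
  rank-mono {x} {y} x≺y = subst (ℕ._< rank y)
    (cong length (filter-absorbs (_<? x) (_<? y) (λ z≺x → ≺-trans z≺x x≺y) (allFin n)))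
    (filter-notAll (_<? x) (below y)
      (Any.map (λ { refl → irrefl refl }) (∈-filter⁺ (_<? y) (∈-allFin x) x≺y)))

  rank<n : ∀ y → rank y ℕ.< n
  rank<n y = subst (rank y ℕ.<_) (length-tabulate _)
    (filter-notAll (_<? y) (allFin n) (Any.map (λ { refl → irrefl refl }) (∈-allFin y)))

  position : Fin n → Fin n
  position y = fromℕ< (rank<n y)

  position-mono : ∀ {x y} → x ≺ y → position x < position y
  position-mono {x} {y} x≺y =
    subst₂ ℕ._<_ (sym (Fin.toℕ-fromℕ< (rank<n x))) (sym (Fin.toℕ-fromℕ< (rank<n y))) (rank-mono x≺y)

  position-reflects : ∀ {x y} → position x < position y → x ≺ y
  position-reflects {x} {y} p<q with compare x y
  ... | tri< x≺y _ _ = x≺y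
  ... | tri≈ _ refl _ = contradiction p<q (Fin.<-irrefl refl)
  ... | tri> _ _ y≺x = contradiction p<q (Fin.<-asym (position-mono y≺x))

  position-injective : Injective _≡_ _≡_ position
  position-injective {x} {y} p≡q with compare x y
  ... | tri< x≺y _ _ = contradiction (position-mono x≺y) (Fin.<-irrefl p≡q)
  ... | tri≈ _ x≡y _ = x≡y
  ... | tri> _ _ y≺x = contradiction (position-mono y≺x) (Fin.<-irrefl (sym p≡q))

  enumerate : Fin n → Fin n
  enumerate i = proj₁ (injective⇒surjective position-injective i)

  position-enumerate : ∀ i → position (enumerate i) ≡ i
  position-enumerate i = proj₂ (injective⇒surjective position-injective i)

  enumerate-bijective : Bijective _≡_ _≡_ enumerate
  enumerate-bijective = injective , surjective
    where
    injective : Injective _≡_ _≡_ enumerate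
    injective {i} {j} eq =
      trans (sym (position-enumerate i)) (trans (cong position eq) (position-enumerate j))
    surjective : Surjective _≡_ _≡_ enumerate
    surjective y = position y , λ { refl → position-injective (position-enumerate (position y)) }

  enumerate-mono : ∀ {i j} → i < j → enumerate i ≺ enumerate j
  enumerate-mono {i} {j} i<j =
    position-reflects (subst₂ _<_ (sym (position-enumerate i)) (sym (position-enumerate j)) i<j)

Umbrella : ∀ {A : Set} → Rel A 0ℓ → Rel A 0ℓ → Set
Umbrella _~_ _<ᵤ_ = ∀ {x y z} → x <ᵤ y → y <ᵤ z → x ~ z → x ~ y × y ~ z

record UmbrellaOrdering {n} (_~_ : Rel (Fin n) 0ℓ) : Set₁ where
  field
    _⋖_                : Rel (Fin n) 0ℓ
    isStrictTotalOrder : IsStrictTotalOrder _≡_ _⋖_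
    umbrella           : Umbrella _~_ _⋖_

EdgeIn : ∀ {A : Set} → Rel A 0ℓ → (A → Set) → Rel A 0ℓ
EdgeIn _~_ P x y = x ~ y × P x × P y

module UmbrellaOrderedGraph {n} {_~_ : Rel (Fin n) 0ℓ}
  (~-sym : ∀ {x y} → x ~ y → y ~ x) (_~?_ : Decidable _~_)
  (ordering : UmbrellaOrdering _~_) where

  open UmbrellaOrdering ordering
  open IsStrictTotalOrder isStrictTotalOrder public
    using (compare; _<?_; _≟_; irrefl; isStrictPartialOrder) renaming (trans to ⋖-trans)
  open import Relation.Binary.Construct.StrictToNonStrict _≡_ _⋖_ public using (_≤_; decidable)

  Connected : Rel (Fin n) 0ℓ
  Connected = Star _~_

  Between : Fin n → Fin n → Fin n → Set
  Between l h z = l ≤ z × z ≤ h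

  HasUpperNeighbour : Fin n → Set
  HasUpperNeighbour p = Σ (Fin n) λ b → p ⋖ b × p ~ b

  ⋖⇒≢ : ∀ {u v} → u ⋖ v → u ≢ v
  ⋖⇒≢ u⋖v refl = irrefl refl u⋖v

  ⋖-or-≥ : ∀ x y → x ⋖ y ⊎ y ≤ x
  ⋖-or-≥ x y with compare x y
  ... | tri< x⋖y _ _ = inj₁ x⋖y
  ... | tri≈ _ x≡y _ = inj₂ (inj₂ (sym x≡y))
  ... | tri> _ _ y⋖x = inj₂ (inj₁ y⋖x)

  ≤-⋖-trans : ∀ {x y z} → x ≤ y → y ⋖ z → x ⋖ z
  ≤-⋖-trans (inj₁ x⋖y) y⋖z = ⋖-trans x⋖y y⋖z
  ≤-⋖-trans (inj₂ refl) y⋖z = y⋖z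

  umbrella-right : ∀ {a p b} → a ≤ p → p ⋖ b → a ~ b → p ~ b
  umbrella-right (inj₁ a⋖p) p⋖b a~b = proj₂ (umbrella a⋖p p⋖b a~b)
  umbrella-right (inj₂ refl) _ a~b = a~b

  umbrella-left : ∀ {a p b} → a ⋖ p → p ≤ b → a ~ b → a ~ p
  umbrella-left a⋖p (inj₁ p⋖b) a~b = proj₁ (umbrella a⋖p p⋖b a~b)
  umbrella-left _ (inj₂ refl) a~b = a~b

  connected-sym : ∀ {u v} → Connected u v → Connected v u
  connected-sym = reverse ~-sym

  within-sym : ∀ {P u v} → Star (EdgeIn _~_ P) u v → Star (EdgeIn _~_ P) v u
  within-sym = reverse λ (u~v , Pu , Pv) → ~-sym u~v , Pv , Pu

  connected⇒hasUpperNeighbour : ∀ {x y p} → Connected x y → x ≤ p → p ⋖ y → HasUpperNeighbour p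
  connected⇒hasUpperNeighbour ε x≤p p⋖x = contradiction (≤-⋖-trans x≤p p⋖x) (irrefl refl)
  connected⇒hasUpperNeighbour {p = p} (_◅_ {j = c} x~c c↝y) x≤p p⋖y with compare p c
  ... | tri< p⋖c _ _ = c , p⋖c , umbrella-right x≤p p⋖c x~c
  ... | tri≈ _ refl _ = connected⇒hasUpperNeighbour c↝y (inj₂ refl) p⋖y
  ... | tri> _ _ c⋖p = connected⇒hasUpperNeighbour c↝y (inj₁ c⋖p) p⋖y

  -- Greedy walk: jump from u to an upper neighbour b; once b ≥ v the umbrella property gives u ~ v.
  climb : ∀ {l u v} → Acc (flip _⋖_) u → l ≤ u → u ≤ v →
          (∀ {p} → l ≤ p → p ⋖ v → HasUpperNeighbour p) → Star (EdgeIn _~_ (Between l v)) u v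
  climb _ _ (inj₂ refl) _ = ε
  climb {l} {u} {v} (acc rec) l≤u (inj₁ u⋖v) up with up l≤u u⋖v
  ... | b , u⋖b , u~b with ⋖-or-≥ b v
  ...   | inj₁ b⋖v = (u~b , (l≤u , inj₁ u⋖v) , (l≤b , inj₁ b⋖v)) ◅ climb (rec u⋖b) l≤b (inj₁ b⋖v) up
    where l≤b = inj₁ (≤-⋖-trans l≤u u⋖b)
  ...   | inj₂ v≤b = (umbrella-left u⋖v v≤b u~b , (l≤u , inj₁ u⋖v) , (l≤v , inj₂ refl)) ◅ ε
    where l≤v = inj₁ (≤-⋖-trans l≤u u⋖v)

  upperNeighbours⇒within : ∀ {u v} → u ≤ v → (∀ {p} → u ≤ p → p ⋖ v → HasUpperNeighbour p) →
                           Star (EdgeIn _~_ (Between u v)) u v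
  upperNeighbours⇒within = climb (spo-noetherian isStrictPartialOrder _) (inj₂ refl)

  connected-within : ∀ {u v} → u ≤ v → Connected u v → Star (EdgeIn _~_ (Between u v)) u v
  connected-within u≤v u↝v = upperNeighbours⇒within u≤v (connected⇒hasUpperNeighbour u↝v)

  connected-ordered? : ∀ {u v} → u ⋖ v → Dec (Connected u v)
  connected-ordered? {u} {v} u⋖v =
    map′ (λ up → Star-map proj₁ (upperNeighbours⇒within (inj₁ u⋖v) λ {p} → up p))
         (λ u↝v p → connected⇒hasUpperNeighbour u↝v)
         (Fin.all? λ p → decidable _≟_ _<?_ u p →-dec (p <? v →-dec hasUpperNeighbour? p))
    where
    hasUpperNeighbour? : ∀ p → Dec (HasUpperNeighbour p)
    hasUpperNeighbour? p = Fin.any? λ b → (p <? b) ×-dec (p ~? b)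

  connected? : Decidable Connected
  connected? u v with compare u v
  ... | tri< u⋖v _ _ = connected-ordered? u⋖v
  ... | tri≈ _ refl _ = yes ε
  ... | tri> _ _ v⋖u = map′ connected-sym connected-sym (connected-ordered? v⋖u)

module ProperIntervalOrdering {n} {G : Rel (Fin n) 0ℓ} (proper-interval : ProperIntervalGraph G) where

  open Interval

  I : Fin n → Interval
  I = proj₁ proper-interval

  valid : ∀ v → ValidInterval (I v)
  valid = proj₁ (proj₂ proper-interval)

  inclusion-free : ∀ u v → I u ⊆I I v → I v ⊆I I u
  inclusion-free = proj₁ (proj₂ (proj₂ proper-interval))

  intersect⇒G : ∀ u v → Intersect (I u) (I v) → G u v
  intersect⇒G u v = proj₂ (proj₂ (proj₂ (proj₂ proper-interval)) u v)

  G⇒intersect : ∀ u v → G u v → Intersect (I u) (I v)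
  G⇒intersect u v = proj₁ (proj₂ (proj₂ (proj₂ proper-interval)) u v)

  G? : Decidable G
  G? u v = map′ (intersect⇒G u v) (G⇒intersect u v) ((lo (I u) ℚ.≤? hi (I v)) ×-dec (lo (I v) ℚ.≤? hi (I u)))

  _≺_ : Rel (Fin n) 0ℓ
  _≺_ = ×-Lex _≡_ ℚ._<_ _<_ on λ v → lo (I v) , v

  ≺-irrefl : Irreflexive _≡_ _≺_
  ≺-irrefl refl = ×-irreflexive {_≈₁_ = _≡_} {_<₁_ = ℚ._<_} {_≈₂_ = _≡_} {_<₂_ = _<_}
                    ℚ.<-irrefl Fin.<-irrefl (refl , refl)

  ≺-trans : Transitive _≺_
  ≺-trans = ×-transitive {_≈₁_ = _≡_} {_<₁_ = ℚ._<_} {_<₂_ = _<_}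
              isEquivalence (resp₂ ℚ._<_) ℚ.<-trans Fin.<-trans

  ≺-total : ∀ {u v} → u ≢ v → u ≺ v ⊎ v ≺ u
  ≺-total {u} {v} u≢v with ×-compare sym ℚ.<-cmp Fin.<-cmp (lo (I u) , u) (lo (I v) , v)
  ... | tri< u≺v _ _ = inj₁ u≺v
  ... | tri≈ _ (_ , u≡v) _ = contradiction u≡v u≢v
  ... | tri> _ _ v≺u = inj₂ v≺u

  lo-mono : ∀ {u v} → u ≺ v → lo (I u) ℚ.≤ lo (I v)
  lo-mono (inj₁ lu<lv) = ℚ.<⇒≤ lu<lv
  lo-mono (inj₂ (lu≡lv , _)) = ℚ.≤-reflexive lu≡lv

  hi-mono : ∀ {u v} → u ≺ v → hi (I u) ℚ.≤ hi (I v)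
  hi-mono {u} {v} u≺v with ℚ.≤-total (hi (I u)) (hi (I v))
  ... | inj₁ hu≤hv = hu≤hv
  ... | inj₂ hv≤hu = proj₂ (inclusion-free v u (lo-mono u≺v , hv≤hu))

  ≺-umbrella : Umbrella G _≺_
  ≺-umbrella {x} {y} {z} x≺y y≺z x~z =
    intersect⇒G x y (ℚ.≤-trans (lo-mono x≺y) (valid y) , ℚ.≤-trans (lo-mono y≺z) lz≤hx) ,
    intersect⇒G y z (ℚ.≤-trans (lo-mono y≺z) (valid z) , ℚ.≤-trans lz≤hx (hi-mono x≺y))
    where lz≤hx = proj₂ (G⇒intersect x z x~z)

  umbrellaOrdering : UmbrellaOrdering G
  umbrellaOrdering = record
    { isStrictTotalOrder = total⇒isStrictTotalOrder Fin._≟_ ≺-irrefl ≺-trans ≺-total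
    ; umbrella = ≺-umbrella
    }

module Orientation {n} (H : Digraph n) (H-refl : Reflexive H) (H-semicomplete : Semicomplete H)
  (R-free : ¬ InducedSub R H) (C3*-free : ¬ InducedSub C3* H)
  (_~?_ : Decidable (Sym H)) (ordering : UmbrellaOrdering (Sym H)) where

  _~_ : Rel (Fin n) 0ℓ
  _~_ = Sym H

  ~-sym : ∀ {x y} → x ~ y → y ~ x
  ~-sym (xy , yx) = yx , xy

  open UmbrellaOrdering ordering using (_⋖_; umbrella)
  open UmbrellaOrderedGraph ~-sym _~?_ ordering

  _⇾_ : Rel (Fin n) 0ℓ
  x ⇾ y = H x y × ¬ H y x

  ⇾⇒≢ : ∀ {x y} → x ⇾ y → x ≢ y
  ⇾⇒≢ {x} (_ , ¬xx) refl = ¬xx (H-refl x)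

  ⇾-asym : ∀ {x y} → x ⇾ y → ¬ y ⇾ x
  ⇾-asym (xy , _) (_ , ¬xy) = ¬xy xy

  ≁⇒≢ : ∀ {x y} → ¬ x ~ y → x ≢ y
  ≁⇒≢ {x} x≁x refl = x≁x (H-refl x , H-refl x)

  nonadjacent-⇾ : ∀ {x y} → x ≢ y → ¬ x ~ y → x ⇾ y ⊎ y ⇾ x
  nonadjacent-⇾ {x} {y} x≢y x≁y with H-semicomplete x y x≢y
  ... | inj₁ xy = inj₁ (xy , λ yx → x≁y (xy , yx))
  ... | inj₂ yx = inj₂ (yx , λ xy → x≁y (xy , yx))

  triangle : Fin n → Fin n → Fin n → Fin 3 → Fin n
  triangle x y z 0F = x
  triangle x y z 1F = y
  triangle x y z 2F = z

  triangle-injective : ∀ {x y z} → x ≢ y → y ≢ z → x ≢ z → Injective _≡_ _≡_ (triangle x y z)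
  triangle-injective x≢y y≢z x≢z {0F} {0F} _ = refl
  triangle-injective x≢y y≢z x≢z {0F} {1F} x≡y = contradiction x≡y x≢y
  triangle-injective x≢y y≢z x≢z {0F} {2F} x≡z = contradiction x≡z x≢z
  triangle-injective x≢y y≢z x≢z {1F} {0F} y≡x = contradiction (sym y≡x) x≢y
  triangle-injective x≢y y≢z x≢z {1F} {1F} _ = refl
  triangle-injective x≢y y≢z x≢z {1F} {2F} y≡z = contradiction y≡z y≢z
  triangle-injective x≢y y≢z x≢z {2F} {0F} z≡x = contradiction (sym z≡x) x≢z
  triangle-injective x≢y y≢z x≢z {2F} {1F} z≡y = contradiction (sym z≡y) y≢z
  triangle-injective x≢y y≢z x≢z {2F} {2F} _ = refl

  Induces : Digraph 3 → (Fin 3 → Fin n) → Set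
  Induces B f = ∀ i j → (H (f i) (f j) → B i j) × (B i j → H (f i) (f j))

  present : ∀ {A : Set} → A → (A → ⊤) × (⊤ → A)
  present a = (λ _ → tt) , (λ _ → a)

  absent : ∀ {A : Set} → ¬ A → (A → ⊥) × (⊥ → A)
  absent ¬a = ¬a , ⊥-elim

  no-R : ∀ {x y z} → x ⇾ y → y ⇾ z → ¬ x ~ z
  no-R {x} {y} {z} x⇾y y⇾z x~z =
    R-free (triangle x y z , triangle-injective (⇾⇒≢ x⇾y) (⇾⇒≢ y⇾z) x≢z , arcs)
    where
    x≢z : x ≢ z
    x≢z refl = ⇾-asym x⇾y y⇾z
    arcs : Induces R (triangle x y z)
    arcs 0F 0F = present (H-refl x)
    arcs 0F 1F = present (proj₁ x⇾y)
    arcs 0F 2F = present (proj₁ x~z)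
    arcs 1F 0F = absent (proj₂ x⇾y)
    arcs 1F 1F = present (H-refl y)
    arcs 1F 2F = present (proj₁ y⇾z)
    arcs 2F 0F = present (proj₂ x~z)
    arcs 2F 1F = absent (proj₂ y⇾z)
    arcs 2F 2F = present (H-refl z)

  no-C3 : ∀ {x y z} → x ⇾ y → y ⇾ z → ¬ z ⇾ x
  no-C3 {x} {y} {z} x⇾y y⇾z z⇾x =
    C3*-free (triangle x y z , triangle-injective (⇾⇒≢ x⇾y) (⇾⇒≢ y⇾z) (⇾⇒≢ z⇾x ∘ sym) , arcs)
    where
    arcs : Induces C3* (triangle x y z)
    arcs 0F 0F = present (H-refl x)
    arcs 0F 1F = present (proj₁ x⇾y)
    arcs 0F 2F = absent (proj₂ z⇾x)
    arcs 1F 0F = absent (proj₂ x⇾y)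
    arcs 1F 1F = present (H-refl y)
    arcs 1F 2F = present (proj₁ y⇾z)
    arcs 2F 0F = present (proj₁ z⇾x)
    arcs 2F 1F = absent (proj₂ y⇾z)
    arcs 2F 2F = present (H-refl z)

  ⇾-stableˡ : ∀ {x y w} → x ~ y → ¬ y ~ w → w ⇾ x → w ⇾ y
  ⇾-stableˡ x~y y≁w w⇾x with nonadjacent-⇾ (≁⇒≢ y≁w) y≁w
  ... | inj₁ y⇾w = contradiction (~-sym x~y) (no-R y⇾w w⇾x)
  ... | inj₂ w⇾y = w⇾y

  ⇾-stableʳ : ∀ {x y w} → x ~ y → ¬ y ~ w → x ⇾ w → y ⇾ w
  ⇾-stableʳ x~y y≁w x⇾w with nonadjacent-⇾ (≁⇒≢ y≁w) y≁w
  ... | inj₁ y⇾w = y⇾w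
  ... | inj₂ w⇾y = contradiction x~y (no-R x⇾w w⇾y)

  ⇾-transportˡ : ∀ {P w x y} → (∀ {z} → P z → ¬ z ~ w) → Star (EdgeIn _~_ P) x y → w ⇾ x → w ⇾ y
  ⇾-transportˡ avoid ε = id
  ⇾-transportˡ avoid ((x~c , _ , Pc) ◅ c↝y) = ⇾-transportˡ avoid c↝y ∘ ⇾-stableˡ x~c (avoid Pc)

  ⇾-transportʳ : ∀ {P w x y} → (∀ {z} → P z → ¬ z ~ w) → Star (EdgeIn _~_ P) x y → x ⇾ w → y ⇾ w
  ⇾-transportʳ avoid ε = id
  ⇾-transportʳ avoid ((x~c , _ , Pc) ◅ c↝y) = ⇾-transportʳ avoid c↝y ∘ ⇾-stableʳ x~c (avoid Pc)

  within-component : ∀ {x y} → Connected x y → Star (EdgeIn _~_ (Connected x)) x y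
  within-component ε = ε
  within-component (x~c ◅ c↝y) =
    (x~c , ε , x~c ◅ ε) ◅ Star-map (λ (e , c↝z , c↝z′) → e , x~c ◅ c↝z , x~c ◅ c↝z′) (within-component c↝y)

  outside-component : ∀ {x w z} → ¬ Connected x w → Connected x z → ¬ z ~ w
  outside-component x↝̸w x↝z z~w = x↝̸w (x↝z ◅◅ z~w ◅ ε)

  ⇾-componentˡ : ∀ {x y w} → Connected x y → ¬ Connected x w → w ⇾ x → w ⇾ y
  ⇾-componentˡ x↝y x↝̸w = ⇾-transportˡ (outside-component x↝̸w) (within-component x↝y)

  ⇾-componentʳ : ∀ {x y w} → Connected x y → ¬ Connected x w → x ⇾ w → y ⇾ w
  ⇾-componentʳ x↝y x↝̸w = ⇾-transportʳ (outside-component x↝̸w) (within-component x↝y)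

  nonadjacent-below : ∀ {x y z} → z ≤ x → x ⋖ y → ¬ x ~ y → ¬ z ~ y
  nonadjacent-below z≤x x⋖y x≁y z~y = x≁y (umbrella-right z≤x x⋖y z~y)

  nonadjacent-above : ∀ {x y z} → x ⋖ y → y ≤ z → ¬ x ~ y → ¬ z ~ x
  nonadjacent-above x⋖y y≤z x≁y z~x = x≁y (umbrella-left x⋖y y≤z (~-sym z~x))

  leftMove : ∀ {α x y} → α ≤ x → x ⋖ y → ¬ x ~ y → Connected α x → y ⇾ α ⇔ y ⇾ x
  leftMove {α} {x} {y} α≤x x⋖y x≁y α↝x =
    mk⇔ (⇾-transportˡ avoid path) (⇾-transportˡ avoid (within-sym path))
    where
    path : Star (EdgeIn _~_ (Between α x)) α x
    path = connected-within α≤x α↝x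
    avoid : ∀ {z} → Between α x z → ¬ z ~ y
    avoid (_ , z≤x) = nonadjacent-below z≤x x⋖y x≁y

  rightMove : ∀ {β x y} → x ⋖ y → y ≤ β → ¬ x ~ y → Connected y β → y ⇾ x ⇔ β ⇾ x
  rightMove {β} {x} {y} x⋖y y≤β x≁y y↝β =
    mk⇔ (⇾-transportʳ avoid path) (⇾-transportʳ avoid (within-sym path))
    where
    path : Star (EdgeIn _~_ (Between y β)) y β
    path = connected-within y≤β y↝β
    avoid : ∀ {z} → Between y β z → ¬ z ~ x
    avoid (y≤z , _) = nonadjacent-above x⋖y y≤z x≁y

  lower-bound : ∀ {x y u} → Connected x u → Connected y u → Σ (Fin n) λ α → α ≤ x × α ≤ y × Connected α u
  lower-bound {x} {y} x↝u y↝u with compare x y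
  ... | tri< x⋖y _ _ = x , inj₂ refl , inj₁ x⋖y , x↝u
  ... | tri≈ _ refl _ = x , inj₂ refl , inj₂ refl , x↝u
  ... | tri> _ _ y⋖x = y , inj₁ y⋖x , inj₂ refl , y↝u

  upper-bound : ∀ {x y u} → Connected x u → Connected y u → Σ (Fin n) λ β → x ≤ β × y ≤ β × Connected β u
  upper-bound {x} {y} x↝u y↝u with compare x y
  ... | tri< x⋖y _ _ = y , inj₁ x⋖y , inj₂ refl , y↝u
  ... | tri≈ _ refl _ = x , inj₂ refl , inj₂ refl , x↝u
  ... | tri> _ _ y⋖x = x , inj₂ refl , inj₁ y⋖x , x↝u

  ReversedPair : Fin n → Fin n → Set
  ReversedPair a b = a ⋖ b × ¬ a ~ b × b ⇾ a

  -- With α = min(a, v) and β = max(b, u) the chain b⇾a, b⇾α, β⇾α, u⇾α, u⇾v is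
  -- obtained by one left or right move per step.
  reversedPair-spreads : ∀ {a b u v} → ReversedPair a b → Connected a u → Connected b u →
                         v ⋖ u → ¬ v ~ u → Connected v u → u ⇾ v
  reversedPair-spreads (a⋖b , a≁b , b⇾a) a↝u b↝u v⋖u v≁u v↝u =
    let α , α≤a , α≤v , α↝u = lower-bound a↝u v↝u
        β , b≤β , u≤β , β↝u = upper-bound b↝u ε
        b⇾α = from (leftMove α≤a a⋖b a≁b (α↝u ◅◅ connected-sym a↝u)) b⇾a
        β⇾α = to (rightMove (≤-⋖-trans α≤a a⋖b) b≤β (nonadjacent-below α≤a a⋖b a≁b)
                            (b↝u ◅◅ connected-sym β↝u)) b⇾α
        u⇾α = from (rightMove (≤-⋖-trans α≤v v⋖u) u≤β (nonadjacent-below α≤v v⋖u v≁u)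
                              (connected-sym β↝u)) β⇾α
    in to (leftMove α≤v v⋖u v≁u (α↝u ◅◅ connected-sym v↝u)) u⇾α
    where open Equivalence

  reversedPair? : ∀ a b → Dec (ReversedPair a b)
  reversedPair? a b with a <? b | a ~? b
  ... | no a⋪b | _ = no (a⋪b ∘ proj₁)
  ... | yes _ | yes a~b = no λ (_ , a≁b , _) → a≁b a~b
  ... | yes a⋖b | no a≁b with nonadjacent-⇾ (⋖⇒≢ a⋖b) a≁b
  ...   | inj₁ a⇾b = no λ (_ , _ , b⇾a) → ⇾-asym a⇾b b⇾a
  ...   | inj₂ b⇾a = yes (a⋖b , a≁b , b⇾a)

  Reversed : Fin n → Set
  Reversed u = Σ (Fin n) λ a → Σ (Fin n) λ b → Connected a u × Connected b u × ReversedPair a b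

  reversed? : ∀ u → Dec (Reversed u)
  reversed? u = Fin.any? λ a → Fin.any? λ b → connected? a u ×-dec connected? b u ×-dec reversedPair? a b

  reversed-connected : ∀ {u v} → Connected u v → Reversed u → Reversed v
  reversed-connected u↝v (a , b , a↝u , b↝u , ab) = a , b , a↝u ◅◅ u↝v , b↝u ◅◅ u↝v , ab

  _◃_ : Rel (Fin n) 0ℓ
  u ◃ v = (¬ Reversed u × u ⋖ v) ⊎ (Reversed u × v ⋖ u)

  ◃-aligned : ∀ {u v w} → Connected u v → u ◃ v → v ◃ w →
              (¬ Reversed u × u ⋖ v × v ⋖ w) ⊎ (Reversed u × w ⋖ v × v ⋖ u)
  ◃-aligned _ (inj₁ (¬r , u⋖v)) (inj₁ (_ , v⋖w)) = inj₁ (¬r , u⋖v , v⋖w)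
  ◃-aligned _ (inj₂ (r , v⋖u)) (inj₂ (_ , w⋖v)) = inj₂ (r , w⋖v , v⋖u)
  ◃-aligned u↝v (inj₁ (¬r , _)) (inj₂ (r , _)) = contradiction (reversed-connected (connected-sym u↝v) r) ¬r
  ◃-aligned u↝v (inj₂ (r , _)) (inj₁ (¬r , _)) = contradiction (reversed-connected u↝v r) ¬r

  ◃-irrefl : ∀ {u} → ¬ u ◃ u
  ◃-irrefl (inj₁ (_ , u⋖u)) = irrefl refl u⋖u
  ◃-irrefl (inj₂ (_ , u⋖u)) = irrefl refl u⋖u

  ◃-trans : ∀ {u v w} → Connected u v → u ◃ v → v ◃ w → u ◃ w
  ◃-trans u↝v u◃v v◃w with ◃-aligned u↝v u◃v v◃w
  ... | inj₁ (¬r , u⋖v , v⋖w) = inj₁ (¬r , ⋖-trans u⋖v v⋖w)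
  ... | inj₂ (r , w⋖v , v⋖u) = inj₂ (r , ⋖-trans w⋖v v⋖u)

  ◃-total : ∀ {u v} → Connected u v → u ≢ v → u ◃ v ⊎ v ◃ u
  ◃-total {u} {v} u↝v u≢v with reversed? u | compare u v
  ... | _     | tri≈ _ u≡v _ = contradiction u≡v u≢v
  ... | no ¬r | tri< u⋖v _ _ = inj₁ (inj₁ (¬r , u⋖v))
  ... | no ¬r | tri> _ _ v⋖u = inj₂ (inj₁ (¬r ∘ reversed-connected (connected-sym u↝v) , v⋖u))
  ... | yes r | tri< u⋖v _ _ = inj₂ (inj₂ (reversed-connected u↝v r , u⋖v))
  ... | yes r | tri> _ _ v⋖u = inj₁ (inj₂ (r , v⋖u))

  ◃-umbrella : ∀ {a b c} → Connected a b → a ◃ b → b ◃ c → a ~ c → a ~ b × b ~ c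
  ◃-umbrella a↝b a◃b b◃c a~c with ◃-aligned a↝b a◃b b◃c
  ... | inj₁ (_ , a⋖b , b⋖c) = umbrella a⋖b b⋖c a~c
  ... | inj₂ (_ , c⋖b , b⋖a) = let c~b , b~a = umbrella c⋖b b⋖a (~-sym a~c) in ~-sym b~a , ~-sym c~b

  ◃⇒⇾ : ∀ {u v} → Connected u v → u ◃ v → ¬ u ~ v → u ⇾ v
  ◃⇒⇾ u↝v (inj₂ ((a , b , a↝u , b↝u , ab) , v⋖u)) u≁v =
    reversedPair-spreads ab a↝u b↝u v⋖u (u≁v ∘ ~-sym) (connected-sym u↝v)
  ◃⇒⇾ {u} {v} u↝v (inj₁ (¬r , u⋖v)) u≁v with nonadjacent-⇾ (⋖⇒≢ u⋖v) u≁v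
  ... | inj₁ u⇾v = u⇾v
  ... | inj₂ v⇾u = contradiction (u , v , ε , connected-sym u↝v , u⋖v , u≁v , v⇾u) ¬r

  _⊏_ : Rel (Fin n) 0ℓ
  u ⊏ v = (Connected u v × u ◃ v) ⊎ (¬ Connected u v × u ⇾ v)

  ⊏-irrefl : ∀ {u} → ¬ u ⊏ u
  ⊏-irrefl (inj₁ (_ , u◃u)) = ◃-irrefl u◃u
  ⊏-irrefl (inj₂ (u↝̸u , _)) = u↝̸u ε

  ⊏-trans : ∀ {u v w} → u ⊏ v → v ⊏ w → u ⊏ w
  ⊏-trans (inj₁ (u↝v , u◃v)) (inj₁ (v↝w , v◃w)) = inj₁ (u↝v ◅◅ v↝w , ◃-trans u↝v u◃v v◃w)
  ⊏-trans (inj₁ (u↝v , _)) (inj₂ (v↝̸w , v⇾w)) =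
    inj₂ ((λ u↝w → v↝̸w (connected-sym u↝v ◅◅ u↝w)) , ⇾-componentʳ (connected-sym u↝v) v↝̸w v⇾w)
  ⊏-trans (inj₂ (u↝̸v , u⇾v)) (inj₁ (v↝w , _)) =
    inj₂ ((λ u↝w → u↝̸v (u↝w ◅◅ connected-sym v↝w)) , ⇾-componentˡ v↝w (u↝̸v ∘ connected-sym) u⇾v)
  ⊏-trans {u} {v} {w} (inj₂ (u↝̸v , u⇾v)) (inj₂ (v↝̸w , v⇾w)) with connected? u w
  ... | yes u↝w = contradiction (⇾-componentʳ u↝w u↝̸v u⇾v) (⇾-asym v⇾w)
  ... | no u↝̸w with nonadjacent-⇾ (λ { refl → u↝̸w ε }) (u↝̸w ∘ (_◅ ε))
  ...   | inj₁ u⇾w = inj₂ (u↝̸w , u⇾w)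
  ...   | inj₂ w⇾u = contradiction w⇾u (no-C3 u⇾v v⇾w)

  ⊏-total : ∀ {u v} → u ≢ v → u ⊏ v ⊎ v ⊏ u
  ⊏-total {u} {v} u≢v with connected? u v
  ... | yes u↝v = Sum.map (inj₁ ∘ (u↝v ,_)) (inj₁ ∘ (connected-sym u↝v ,_)) (◃-total u↝v u≢v)
  ... | no u↝̸v with nonadjacent-⇾ u≢v (u↝̸v ∘ (_◅ ε))
  ...   | inj₁ u⇾v = inj₁ (inj₂ (u↝̸v , u⇾v))
  ...   | inj₂ v⇾u = inj₂ (inj₂ (u↝̸v ∘ connected-sym , v⇾u))

  ⊏-isStrictTotalOrder : IsStrictTotalOrder _≡_ _⊏_
  ⊏-isStrictTotalOrder = total⇒isStrictTotalOrder Fin._≟_ (λ { refl → ⊏-irrefl }) ⊏-trans ⊏-total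

  ⊏-umbrella : Umbrella _~_ _⊏_
  ⊏-umbrella (inj₁ (a↝b , a◃b)) (inj₁ (_ , b◃c)) a~c = ◃-umbrella a↝b a◃b b◃c a~c
  ⊏-umbrella (inj₁ (a↝b , _)) (inj₂ (b↝̸c , _)) a~c = contradiction (connected-sym a↝b ◅◅ a~c ◅ ε) b↝̸c
  ⊏-umbrella (inj₂ (a↝̸b , _)) (inj₁ (b↝c , _)) a~c = contradiction (a~c ◅ connected-sym b↝c) a↝̸b
  ⊏-umbrella (inj₂ (_ , a⇾b)) (inj₂ (_ , b⇾c)) a~c = contradiction a~c (no-R a⇾b b⇾c)

  ⊏⇒arc : ∀ {u v} → u ⊏ v → H u v
  ⊏⇒arc (inj₂ (_ , u⇾v)) = proj₁ u⇾v
  ⊏⇒arc {u} {v} (inj₁ (u↝v , u◃v)) with u ~? v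
  ... | yes u~v = proj₁ u~v
  ... | no u≁v = proj₁ (◃⇒⇾ u↝v u◃v u≁v)

lemma2p12 : (n : ℕ) (H : Digraph n) →
    ReflexiveSemicomplete H →
    ¬ InducedSub R H →
    ¬ InducedSub C3* H →
    ProperIntervalGraph (Sym H) →
    Σ (Fin n → Fin n) λ v → Bijective _≡_ _≡_ v ×
      ((i j k : Fin n) → i < j → j < k → Sym H (v i) (v k) →
        Sym H (v i) (v j) × Sym H (v j) (v k)) ×
      ((i j : Fin n) → i < j → H (v i) (v j))
lemma2p12 n H (H-refl , H-semicomplete) R-free C3*-free proper-interval =
  enumerate , enumerate-bijective ,
  (λ i j k i<j j<k → ⊏-umbrella (enumerate-mono i<j) (enumerate-mono j<k)) ,
  (λ i j i<j → ⊏⇒arc (enumerate-mono i<j))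
  where
  open ProperIntervalOrdering proper-interval using (G?; umbrellaOrdering)
  open Orientation H H-refl H-semicomplete R-free C3*-free G? umbrellaOrdering
  open Enumeration ⊏-isStrictTotalOrder
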